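{- Let $H\le{\rm Sym}(n)$ admit a block system $\mathcal B$ and let $K\triangleleft H$ be such that (1) $K\le{\rm fix}_H(\mathcal B)$; (2) $K=T^\ell$ is a direct product of isomorphic nonabelian simple groups $T$; and (3) $K|_B\cong T$ and $K|_B$ is transitive on $B$ for every $B\in\mathcal B$. Let $L$ be a minimal nontrivial normal subgroup of $K$. Then ${\rm supp}(L)$ is a block of $H$. Furthermore, if $\mathcal C$ is the block system of $H$ that includes ${\rm supp}(L)$, then $\mathcal B\le\mathcal C$.
   Context: ${\rm fix}_H(\mathcal B)=\{h\in H: h(B)=B \text{ for all } B\in\mathcal B\}$. For a block $B$, $K|_B$ denotes the permutation group on $B$ induced by $K$ (when $K$ fixes $B$ setwise). ${\rm supp}(L)$ is the set of points moved by some element of $L$. For block systems, $\mathcal B\le\mathcal C$ means every block of $\mathcal C$ is a union of blocks of $\mathcal B$. -}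

module Defs where

open import Level using (Level; _⊔_; 0ℓ)
open import Data.Nat.Base using (ℕ)
open import Data.Fin.Base using (Fin)
open import Data.Fin.Permutation using (Permutation′; _⟨$⟩ʳ_; id; flip; _∘ₚ_)
open import Data.Product.Base using (Σ; ∃; ∃-syntax; _×_; _,_; proj₁)
open import Data.Unit.Base using (⊤)
open import Relation.Nullary using (¬_; Dec)
open import Relation.Binary.Structures using (IsEquivalence)
open import Relation.Binary.PropositionalEquality using (_≡_; _≢_)
open import Algebra.Bundles using (Group; RawGroup)
open import Algebra.Morphism.Structures using (module GroupMorphisms)
import Algebra.Construct.Pointwise as Pointwise

private
  variable
    n : ℕ

Perm : ℕ → Set
Perm n = Permutation′ n

-- product in Sym(n):  (g · h) x = g (h x)
_·_ : Perm n → Perm n → Perm n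
g · h = h ∘ₚ g

_⁻¹ₚ : Perm n → Perm n
g ⁻¹ₚ = flip g

record PermGroup (n : ℕ) : Set₁ where
  field
    mem     : Perm n → Set
    mem-dec : ∀ g → Dec (mem g)
    mem-resp : ∀ {g h} → (∀ x → g ⟨$⟩ʳ x ≡ h ⟨$⟩ʳ x) → mem g → mem h
    mem-id  : mem id
    mem-·   : ∀ {g h} → mem g → mem h → mem (g · h)
    mem-inv : ∀ {g} → mem g → mem (g ⁻¹ₚ)

open PermGroup public

_≤G_ : PermGroup n → PermGroup n → Set
K ≤G H = ∀ g → mem K g → mem H g

_◁_ : PermGroup n → PermGroup n → Set
K ◁ H = (K ≤G H) × (∀ h k → mem H h → mem K k → mem K ((h · k) · (h ⁻¹ₚ)))

Nontrivial : PermGroup n → Set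
Nontrivial G = ∃[ g ] (mem G g × ∃[ x ] (g ⟨$⟩ʳ x ≢ x))

MinimalNormal : PermGroup n → PermGroup n → Set₁
MinimalNormal {n} L K =
  (L ◁ K) × Nontrivial L ×
  ((M : PermGroup n) → M ◁ K → M ≤G L → Nontrivial M → L ≤G M)

Transitive : PermGroup n → Set
Transitive {n} H = (x y : Fin n) → ∃[ h ] (mem H h × h ⟨$⟩ʳ x ≡ y)

Supp : PermGroup n → Fin n → Set
Supp L x = ∃[ g ] (mem L g × g ⟨$⟩ʳ x ≢ x)

MapsOnto : Perm n → (Fin n → Set) → Set
MapsOnto {n} h S =
  ((x : Fin n) → S x → S (h ⟨$⟩ʳ x)) ×
  ((y : Fin n) → S y → ∃[ x ] (S x × h ⟨$⟩ʳ x ≡ y))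

IsBlock : PermGroup n → (Fin n → Set) → Set
IsBlock {n} H S =
  (∃[ x ] S x) ×
  (∀ h → mem H h → (∃[ x ] (S x × S (h ⟨$⟩ʳ x))) → MapsOnto h S)

-- A block system of H: an H-invariant partition of Fin n,
-- given by its equivalence relation (blocks = equivalence classes)
record BlockSystem {n : ℕ} (H : PermGroup n) : Set₁ where
  field
    _~_   : Fin n → Fin n → Set
    isEquivalence : IsEquivalence _~_
    invariant : ∀ h x y → mem H h → x ~ y → (h ⟨$⟩ʳ x) ~ (h ⟨$⟩ʳ y)

  Block : Fin n → Fin n → Set
  Block x y = x ~ y

open BlockSystem public

HasBlock : {H : PermGroup n} → BlockSystem H → (Fin n → Set) → Set
HasBlock {n} 𝓒 S =
  ∃[ x ] ((y : Fin n) → (Block 𝓒 x y → S y) × (S y → Block 𝓒 x y))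

-- 𝓑 ≤ 𝓒 : every block of 𝓒 is a union of blocks of 𝓑
_≤B_ : {H : PermGroup n} → BlockSystem H → BlockSystem H → Set
_≤B_ {n} 𝓑 𝓒 = (x y : Fin n) → Block 𝓑 x y → Block 𝓒 x y

FixesBlocks : {H : PermGroup n} → BlockSystem H → Perm n → Set
FixesBlocks {n} 𝓑 h = (x : Fin n) → MapsOnto h (Block 𝓑 x)

-- K|_P : the group induced by K on a K-invariant set P, as a raw group:
-- elements of K, two being identified when they agree on P.
Restrict : PermGroup n → (Fin n → Set) → RawGroup 0ℓ 0ℓ
Restrict {n} K P = record
  { Carrier = Σ (Perm n) (mem K)
  ; _≈_ = λ g h → (x : Fin n) → P x → proj₁ g ⟨$⟩ʳ x ≡ proj₁ h ⟨$⟩ʳ x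
  ; _∙_ = λ g h → (proj₁ g · proj₁ h) , mem-· K (Data.Product.Base.proj₂ g) (Data.Product.Base.proj₂ h)
  ; ε = id , mem-id K
  ; _⁻¹ = λ g → (proj₁ g ⁻¹ₚ) , mem-inv K (Data.Product.Base.proj₂ g)
  }

AsGroup : PermGroup n → RawGroup 0ℓ 0ℓ
AsGroup K = Restrict K (λ _ → ⊤)

TransitiveOn : PermGroup n → (Fin n → Set) → Set
TransitiveOn {n} K P =
  (x y : Fin n) → P x → P y → ∃[ g ] (mem K g × g ⟨$⟩ʳ x ≡ y)

_≅_ : ∀ {a b ℓ₁ ℓ₂} → RawGroup a ℓ₁ → RawGroup b ℓ₂ → Set (a ⊔ b ⊔ ℓ₁ ⊔ ℓ₂)
G₁ ≅ G₂ = ∃[ f ] GroupMorphisms.IsGroupIsomorphism G₁ G₂ f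

_^G_ : ∀ {c ℓ} → Group c ℓ → ℕ → Group c ℓ
T ^G k = Pointwise.group (Fin k) T

module _ {c ℓ} (G : Group c ℓ) where
  open Group G

  record IsNormalSubgroup (N : Carrier → Set (c ⊔ ℓ)) : Set (c ⊔ ℓ) where
    field
      resp  : ∀ {x y} → x ≈ y → N x → N y
      has-ε : N ε
      ∙-closed : ∀ {x y} → N x → N y → N (x ∙ y)
      ⁻¹-closed : ∀ {x} → N x → N (x ⁻¹)
      conj-closed : ∀ x {y} → N y → N ((x ∙ y) ∙ (x ⁻¹))

  IsSimple : Set (Level.suc (c ⊔ ℓ))
  IsSimple = (∃[ x ] (¬ (x ≈ ε))) ×
    ((N : Carrier → Set (c ⊔ ℓ)) → IsNormalSubgroup N →
       (∃[ x ] (N x × ¬ (x ≈ ε))) → ∀ x → N x)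

  IsNonabelian : Set (c ⊔ ℓ)
  IsNonabelian = ∃[ x ] ∃[ y ] (¬ ((x ∙ y) ≈ (y ∙ x)))

-- A normal subgroup of K whose support meets a block B of 𝓑 induces all of K|_B ≅ T on B,
-- since T is simple. So two minimal normal subgroups L₁, L₂ of K whose supports meet in B
-- contain elements inducing non-commuting elements of T on B; their commutator is then a
-- nontrivial element of L₁ ∩ L₂ ◁ K, and L₁ = L₂ by minimality. Thus distinct minimal normal
-- subgroups of K have disjoint supports. As H permutes the minimal normal subgroups of K by
-- conjugation, supp(L) is a block of H, and as K is transitive on each B, supp(L) is a union
-- of blocks of 𝓑.
module Submission where

open import Defs
open import Level using (Level; Lift; lift; _⊔_)
open import Data.Nat.Base using (ℕ)
open import Data.Fin.Base using (Fin)
open import Data.Fin.Permutation using (_⟨$⟩ʳ_; _⟨$⟩ˡ_; inverseˡ; inverseʳ; id)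
open import Data.Fin.Properties using (¬∀⟶∃¬) renaming (_≟_ to _≟ᶠ_)
open import Data.Product.Base using (_×_; _,_; proj₁; proj₂; ∃-syntax; Σ-syntax)
open import Relation.Nullary using (¬_)
open import Relation.Nullary.Decidable using (_×-dec_)
open import Relation.Binary.PropositionalEquality
  using (_≡_; _≢_; refl; sym; trans; cong; subst; subst₂)
open import Relation.Binary.Structures using (IsEquivalence)
open import Function.Bundles using (Injection)
open import Function.Properties.Inverse using (↔⇒↣)
open import Algebra.Bundles using (Group)
open import Algebra.Morphism.Structures using (module GroupMorphisms)

private
  variable
    n : ℕ
    G H K L L₁ L₂ : PermGroup n
    g h k : Perm n
    x : Fin n

⟨$⟩ʳ-injective : (g : Perm n) {a b : Fin n} → g ⟨$⟩ʳ a ≡ g ⟨$⟩ʳ b → a ≡ b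
⟨$⟩ʳ-injective g = Injection.injective (↔⇒↣ g)

Commute : Perm n → Perm n → Set
Commute a b = ∀ z → (a · b) ⟨$⟩ʳ z ≡ (b · a) ⟨$⟩ʳ z

⁅_,_⁆ : Perm n → Perm n → Perm n
⁅ a , b ⁆ = a · ((b · (a ⁻¹ₚ)) · (b ⁻¹ₚ))

-- ⁅ a , b ⁆ sends (b · a) z to (a · b) z.
commutator-moves : (a b : Perm n) → ¬ Commute a b → ∃[ w ] (⁅ a , b ⁆ ⟨$⟩ʳ w ≢ w)
commutator-moves {n} a b ¬ab with ¬∀⟶∃¬ n _ (λ z → (a · b) ⟨$⟩ʳ z ≟ᶠ (b · a) ⟨$⟩ʳ z) ¬ab
... | z , ab≢ba = (b · a) ⟨$⟩ʳ z , λ eq → ab≢ba (trans (sym sends) eq)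
  where
  sends : ⁅ a , b ⁆ ⟨$⟩ʳ ((b · a) ⟨$⟩ʳ z) ≡ (a · b) ⟨$⟩ʳ z
  sends = cong (λ u → a ⟨$⟩ʳ (b ⟨$⟩ʳ u)) (trans (cong (a ⟨$⟩ˡ_) (inverseˡ b)) (inverseˡ a))

_∩G_ : PermGroup n → PermGroup n → PermGroup n
G ∩G G′ = record
  { mem = λ g → mem G g × mem G′ g
  ; mem-dec = λ g → mem-dec G g ×-dec mem-dec G′ g
  ; mem-resp = λ e (p , p′) → mem-resp G e p , mem-resp G′ e p′
  ; mem-id = mem-id G , mem-id G′
  ; mem-· = λ (p , p′) (q , q′) → mem-· G p q , mem-· G′ p′ q′
  ; mem-inv = λ (p , p′) → mem-inv G p , mem-inv G′ p′
  }

-- conjugate G h = h G h⁻¹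
conjugate : PermGroup n → Perm n → PermGroup n
conjugate G h = record
  { mem = λ g → mem G (((h ⁻¹ₚ) · g) · h)
  ; mem-dec = λ g → mem-dec G _
  ; mem-resp = λ e → mem-resp G (λ x → cong (h ⟨$⟩ˡ_) (e (h ⟨$⟩ʳ x)))
  ; mem-id = mem-resp G (λ x → sym (inverseˡ h)) (mem-id G)
  ; mem-· = λ {g} p q → mem-resp G (λ x → cong (λ y → h ⟨$⟩ˡ (g ⟨$⟩ʳ y)) (inverseʳ h)) (mem-· G p q)
  ; mem-inv = mem-inv G
  }

conjugate-mem : mem G g → mem (conjugate G h) ((h · g) · (h ⁻¹ₚ))
conjugate-mem {G = G} {g} {h} =
  mem-resp G (λ y → sym (trans (inverseˡ h) (cong (g ⟨$⟩ʳ_) (inverseˡ h))))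

conjugate-cancel : mem G ((h · (((h ⁻¹ₚ) · g) · h)) · (h ⁻¹ₚ)) → mem G g
conjugate-cancel {G = G} {h} {g} =
  mem-resp G (λ y → trans (inverseʳ h) (cong (g ⟨$⟩ʳ_) (inverseʳ h)))

∩-normal : L₁ ◁ K → L₂ ◁ K → (L₁ ∩G L₂) ◁ K
∩-normal (L₁≤K , conj₁) (_ , conj₂) =
  (λ g (p , _) → L₁≤K g p) ,
  (λ k g pk (p₁ , p₂) → conj₁ k g pk p₁ , conj₂ k g pk p₂)

commutator-∈-∩ : L₁ ◁ K → L₂ ◁ K → mem L₁ g → mem L₂ h → mem (L₁ ∩G L₂) ⁅ g , h ⁆
commutator-∈-∩ {L₁ = L₁} {L₂ = L₂} {g} {h} (L₁≤K , conj₁) (L₂≤K , conj₂) p q =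
  mem-· L₁ p (conj₁ h (g ⁻¹ₚ) (L₂≤K h q) (mem-inv L₁ p)) ,
  mem-resp L₂ (λ _ → refl) (mem-· L₂ (conj₂ g h (L₁≤K g p) q) (mem-inv L₂ q))

conjugate-normal : K ◁ H → mem H h → L ◁ K → conjugate L h ◁ K
conjugate-normal {K = K} {H = H} {h} {L} (K≤H , conjK) ph (L≤K , conjL) =
  (λ g p → conjugate-cancel {G = K} {h} (conjK h _ ph (L≤K _ p))) ,
  (λ k g pk p → mem-resp L
      (λ x → cong (λ y → h ⟨$⟩ˡ (k ⟨$⟩ʳ y)) (trans (inverseʳ h) (cong (g ⟨$⟩ʳ_) (inverseʳ h))))
      (conjL _ _ (conjK (h ⁻¹ₚ) k (mem-inv H ph) pk) p))

Supp-mono : G ≤G L → Supp G x → Supp L x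
Supp-mono G≤L (g , p , moves) = g , G≤L g p , moves

Supp-conjugate : (h : Perm n) → Supp G x → Supp (conjugate G h) (h ⟨$⟩ʳ x)
Supp-conjugate {G = G} h (g , p , moves) =
  (h · g) · (h ⁻¹ₚ) , conjugate-mem {G = G} {h = h} p ,
  λ eq → moves (⟨$⟩ʳ-injective h (trans (cong (λ y → h ⟨$⟩ʳ (g ⟨$⟩ʳ y)) (sym (inverseˡ h))) eq))

Supp-conjugate⁻ : (h : Perm n) {y : Fin n} → Supp (conjugate G h) y → Supp G (h ⟨$⟩ˡ y)
Supp-conjugate⁻ h (g , p , moves) =
  ((h ⁻¹ₚ) · g) · h , p ,
  λ eq → moves (trans (cong (g ⟨$⟩ʳ_) (sym (inverseʳ h))) (⟨$⟩ʳ-injective (h ⁻¹ₚ) eq))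

Supp-normal-invariant : L ◁ K → mem K k → Supp L x → Supp L (k ⟨$⟩ʳ x)
Supp-normal-invariant {k = k} (_ , conjL) pk (l , pl , moves) =
  (k · l) · (k ⁻¹ₚ) , conjL k l pk pl ,
  λ eq → moves (⟨$⟩ʳ-injective k (trans (cong (λ u → k ⟨$⟩ʳ (l ⟨$⟩ʳ u)) (sym (inverseˡ k))) eq))

Supp-nonempty : Nontrivial L → ∃[ x ] Supp L x
Supp-nonempty (g , p , x , moves) = x , g , p , moves

Nontrivial-conjugate : (h : Perm n) → Nontrivial G → Nontrivial (conjugate G h)
Nontrivial-conjugate {G = G} h (g , p , x , moves) with Supp-conjugate {G = G} h (g , p , moves)
... | g′ , p′ , moves′ = g′ , p′ , h ⟨$⟩ʳ x , moves′

conjugate-minimalNormal : K ◁ H → mem H h → MinimalNormal L K → MinimalNormal (conjugate L h) K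
conjugate-minimalNormal {K = K} {H = H} {h} {L} K◁H ph (L◁K , ntL , minL) =
  conjugate-normal {K = K} {H} {h} {L} K◁H ph L◁K , Nontrivial-conjugate {G = L} h ntL , minimal
  where
  minimal : (M : PermGroup _) → M ◁ K → M ≤G conjugate L h → Nontrivial M → conjugate L h ≤G M
  minimal M M◁K M≤hLh⁻¹ ntM g pg = conjugate-cancel {G = M} {h} (L≤h⁻¹Mh _ pg)
    where
    h⁻¹Mh≤L : conjugate M (h ⁻¹ₚ) ≤G L
    h⁻¹Mh≤L g′ p =
      mem-resp L (λ x → trans (inverseˡ h) (cong (g′ ⟨$⟩ʳ_) (inverseˡ h))) (M≤hLh⁻¹ _ p)
    L≤h⁻¹Mh : L ≤G conjugate M (h ⁻¹ₚ)
    L≤h⁻¹Mh = minL (conjugate M (h ⁻¹ₚ))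
                (conjugate-normal {K = K} {H} {h ⁻¹ₚ} {M} K◁H (mem-inv H ph) M◁K)
                h⁻¹Mh≤L (Nontrivial-conjugate {G = M} (h ⁻¹ₚ) ntM)

minimalNormal-≤-of-noncommuting :
  MinimalNormal L₁ K → L₂ ◁ K → mem L₁ g → mem L₂ h → ¬ Commute g h → L₁ ≤G L₂
minimalNormal-≤-of-noncommuting {L₁ = L₁} {K = K} {L₂ = L₂} {g} {h}
                                (L₁◁K , _ , minL₁) L₂◁K p q ¬gh l pl =
  proj₂ (minL₁ (L₁ ∩G L₂) (∩-normal {L₁ = L₁} {K} {L₂} L₁◁K L₂◁K) (λ _ → proj₁) nontrivial l pl)
  where
  nontrivial : Nontrivial (L₁ ∩G L₂)
  nontrivial =
    ⁅ g , h ⁆ , commutator-∈-∩ {L₁ = L₁} {K} {L₂} L₁◁K L₂◁K p q , commutator-moves g h ¬gh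

module RestrictionToSimple {c ℓt} (T : Group c ℓt) {K : PermGroup n} {P : Fin n → Set}
  (iso : Restrict K P ≅ Group.rawGroup T) where

  open Group T renaming (refl to ≈-refl; sym to ≈-sym; trans to ≈-trans)
  open GroupMorphisms.IsGroupIsomorphism (proj₂ iso)

  private
    f = proj₁ iso

  f-irrelevant : {l : Perm n} (p q : mem K l) → f (l , p) ≈ f (l , q)
  f-irrelevant p q = ⟦⟧-cong (λ _ _ → refl)

  Image : (L : PermGroup n) → L ≤G K → Carrier → Set (c ⊔ ℓt)
  Image L L≤K t = Lift (c ⊔ ℓt) (∃[ l ] Σ[ p ∈ mem L l ] f (l , L≤K l p) ≈ t)

  Image-normal : (L◁K : L ◁ K) → IsNormalSubgroup T (Image L (proj₁ L◁K))
  Image-normal {L = L} (L≤K , conjL) = record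
    { resp = λ { e (lift (l , p , fl≈t)) → lift (l , p , ≈-trans fl≈t e) }
    ; has-ε = lift (id , mem-id L , ≈-trans (f-irrelevant _ _) ε-homo)
    ; ∙-closed = λ { (lift (l , p , fl≈t)) (lift (m , q , fm≈u)) →
        lift (l · m , mem-· L p q ,
          ≈-trans (f-irrelevant _ _) (≈-trans (∙-homo (l , _) (m , _)) (∙-cong fl≈t fm≈u))) }
    ; ⁻¹-closed = λ { (lift (l , p , fl≈t)) →
        lift ((l ⁻¹ₚ) , mem-inv L p ,
          ≈-trans (f-irrelevant _ _) (≈-trans (⁻¹-homo (l , _)) (⁻¹-cong fl≈t))) }
    ; conj-closed = conj-closed
    }
    where
    conj-closed : ∀ t {u} → Image L L≤K u → Image L L≤K ((t ∙ u) ∙ t ⁻¹)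
    conj-closed t (lift (l , p , fl≈u)) with surjective t
    ... | (k , pk) , onto =
      lift ((k · l) · (k ⁻¹ₚ) , conjL k l pk p ,
        ≈-trans (f-irrelevant _ _)
          (≈-trans (∙-homo ((k · l) , _) ((k ⁻¹ₚ) , _))
            (∙-cong (≈-trans (∙-homo (k , pk) (l , _)) (∙-cong fk≈t fl≈u))
                    (≈-trans (⁻¹-homo (k , pk)) (⁻¹-cong fk≈t)))))
      where
      fk≈t : f (k , pk) ≈ t
      fk≈t = onto (λ _ _ → refl)

  normal-restriction-onto : IsSimple T → (L◁K : L ◁ K) → P x → Supp L x →
                ∀ t → ∃[ l ] Σ[ p ∈ mem L l ] f (l , proj₁ L◁K l p) ≈ t
  normal-restriction-onto {L = L} {x = x} (_ , simple) L◁K Px (l , pl , moves) t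
    with simple (Image L (proj₁ L◁K)) (Image-normal {L = L} L◁K)
                (f (l , _) , lift (l , pl , ≈-refl) , fl≉ε) t
    where
    fl≉ε : ¬ f (l , proj₁ L◁K l pl) ≈ ε
    fl≉ε fl≈ε = moves (injective (≈-trans fl≈ε (≈-sym ε-homo)) x Px)
  ... | lift image = image

  Commute⇒image-commute : {l m : Perm n} (pl : mem K l) (pm : mem K m) → Commute l m →
                          f (l , pl) ∙ f (m , pm) ≈ f (m , pm) ∙ f (l , pl)
  Commute⇒image-commute pl pm lm≡ml = begin
    f (_ , pl) ∙ f (_ , pm) ≈⟨ ∙-homo _ _ ⟨
    f (_ , mem-· K pl pm)   ≈⟨ ⟦⟧-cong (λ z _ → lm≡ml z) ⟩
    f (_ , mem-· K pm pl)   ≈⟨ ∙-homo _ _ ⟩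
    f (_ , pm) ∙ f (_ , pl) ∎
    where open import Relation.Binary.Reasoning.Setoid setoid

  noncommuting-lifts : IsSimple T → IsNonabelian T → L₁ ◁ K → L₂ ◁ K →
                       P x → Supp L₁ x → Supp L₂ x →
                       ∃[ l₁ ] ∃[ l₂ ] (mem L₁ l₁ × mem L₂ l₂ × ¬ Commute l₁ l₂)
  noncommuting-lifts {L₁ = L₁} {L₂ = L₂} simple (a , b , ab≉ba) L₁◁K L₂◁K Px s₁ s₂
    with normal-restriction-onto {L = L₁} simple L₁◁K Px s₁ a
       | normal-restriction-onto {L = L₂} simple L₂◁K Px s₂ b
  ... | l₁ , p₁ , fl₁≈a | l₂ , p₂ , fl₂≈b =
    l₁ , l₂ , p₁ , p₂ , λ l₁l₂≡l₂l₁ → ab≉ba (begin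
      a ∙ b                   ≈⟨ ∙-cong fl₁≈a fl₂≈b ⟨
      f (l₁ , _) ∙ f (l₂ , _) ≈⟨ Commute⇒image-commute _ _ l₁l₂≡l₂l₁ ⟩
      f (l₂ , _) ∙ f (l₁ , _) ≈⟨ ∙-cong fl₂≈b fl₁≈a ⟩
      b ∙ a                   ∎)
    where open import Relation.Binary.Reasoning.Setoid setoid

minimalNormal-≤-of-supports-meet :
  ∀ {c ℓt} (T : Group c ℓt) → IsSimple T → IsNonabelian T → {P : Fin n → Set} →
  Restrict K P ≅ Group.rawGroup T → MinimalNormal L₁ K → L₂ ◁ K →
  P x → Supp L₁ x → Supp L₂ x → L₁ ≤G L₂
minimalNormal-≤-of-supports-meet {K = K} {L₁ = L₁} {L₂ = L₂} T simple nonabelian {P} iso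
                                 mL₁ L₂◁K Px s₁ s₂
  with RestrictionToSimple.noncommuting-lifts T {K} {P} iso {L₁ = L₁} {L₂ = L₂}
         simple nonabelian (proj₁ mL₁) L₂◁K Px s₁ s₂
... | l₁ , l₂ , p₁ , p₂ , ¬commute =
  minimalNormal-≤-of-noncommuting {L₁ = L₁} {K} {L₂} {g = l₁} {h = l₂} mL₁ L₂◁K p₁ p₂ ¬commute

Supp-isBlock :
  K ◁ H → MinimalNormal L K →
  (∀ L₁ L₂ → MinimalNormal L₁ K → MinimalNormal L₂ K → ∀ {y} → Supp L₁ y → Supp L₂ y → L₁ ≤G L₂) →
  IsBlock H (Supp L)
Supp-isBlock {K = K} {H = H} {L = L} K◁H mL ≤-of-supports-meet =
  Supp-nonempty {L = L} (proj₁ (proj₂ mL)) , mapsOnto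
  where
  mapsOnto : ∀ h → mem H h → ∃[ x ] (Supp L x × Supp L (h ⟨$⟩ʳ x)) → MapsOnto h (Supp L)
  mapsOnto h ph (x , Sx , Shx) =
    (λ y Sy → Supp-mono {G = conjugate L h} {L = L} hLh⁻¹≤L (Supp-conjugate {G = L} h Sy)) ,
    (λ y Sy → h ⟨$⟩ˡ y ,
              Supp-conjugate⁻ {G = L} h (Supp-mono {G = L} {L = conjugate L h} L≤hLh⁻¹ Sy) ,
              inverseʳ h)
    where
    mhLh⁻¹ : MinimalNormal (conjugate L h) K
    mhLh⁻¹ = conjugate-minimalNormal {K = K} {H} {h} {L} K◁H ph mL
    L≤hLh⁻¹ : L ≤G conjugate L h
    L≤hLh⁻¹ = ≤-of-supports-meet L (conjugate L h) mL mhLh⁻¹ Shx (Supp-conjugate {G = L} h Sx)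
    hLh⁻¹≤L : conjugate L h ≤G L
    hLh⁻¹≤L = ≤-of-supports-meet (conjugate L h) L mhLh⁻¹ mL (Supp-conjugate {G = L} h Sx) Shx

Supp-unionOfBlocks : {𝓑 : BlockSystem H} → L ◁ K → (∀ x → TransitiveOn K (Block 𝓑 x)) →
                     ∀ {x y} → Block 𝓑 x y → Supp L x → Supp L y
Supp-unionOfBlocks {L = L} {K = K} {𝓑 = 𝓑} L◁K transitive {x} {y} x~y Sx
  with transitive x x y (IsEquivalence.refl (isEquivalence 𝓑)) x~y
... | k , pk , kx≡y = subst (Supp L) kx≡y (Supp-normal-invariant {L = L} {K} {k} L◁K pk Sx)

-- Transport an arbitrary 𝓑-block into S by some h ∈ H, where it lies in the 𝓒-block S.
unionOfBlocks-≤B : {𝓑 𝓒 : BlockSystem H} {S : Fin n → Set} → Transitive H → ∃[ x ] S x →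
                   (∀ {x y} → Block 𝓑 x y → S x → S y) → HasBlock 𝓒 S → 𝓑 ≤B 𝓒
unionOfBlocks-≤B {H = H} {𝓑 = 𝓑} {𝓒} {S} transitive (s , Ss) S-union (c , S≡𝓒c) x y x~y
  with transitive x s
... | h , ph , hx≡s =
  subst₂ (_~_ 𝓒) (inverseˡ h) (inverseˡ h) (invariant 𝓒 (h ⁻¹ₚ) _ _ (mem-inv H ph) hx~hy)
  where
  module C = IsEquivalence (isEquivalence 𝓒)
  Shx : S (h ⟨$⟩ʳ x)
  Shx = subst S (sym hx≡s) Ss
  Shy : S (h ⟨$⟩ʳ y)
  Shy = S-union (invariant 𝓑 h x y ph x~y) Shx
  hx~hy : _~_ 𝓒 (h ⟨$⟩ʳ x) (h ⟨$⟩ʳ y)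
  hx~hy = C.trans (C.sym (proj₂ (S≡𝓒c _) Shx)) (proj₂ (S≡𝓒c _) Shy)

lemma2p8 : ∀ {c ℓt : Level} {n : ℕ}
    (H K L : PermGroup n) (𝓑 : BlockSystem H)
    (T : Group c ℓt) (ℓ : ℕ) →
    Transitive H →
    K ◁ H →
    (∀ k → mem K k → FixesBlocks 𝓑 k) →
    IsSimple T → IsNonabelian T →
    AsGroup K ≅ Group.rawGroup (T ^G ℓ) →
    (∀ x → (Restrict K (Block 𝓑 x) ≅ Group.rawGroup T) × TransitiveOn K (Block 𝓑 x)) →
    MinimalNormal L K →
    IsBlock H (Supp L) × ((𝓒 : BlockSystem H) → HasBlock 𝓒 (Supp L) → 𝓑 ≤B 𝓒)
lemma2p8 H K L 𝓑 T ℓ transitive K◁H _ simple nonabelian _ onBlocks mL =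
  Supp-isBlock {K = K} {H} {L} K◁H mL ≤-of-supports-meet ,
  λ 𝓒 → unionOfBlocks-≤B {𝓑 = 𝓑} {𝓒} transitive (Supp-nonempty {L = L} (proj₁ (proj₂ mL)))
          (Supp-unionOfBlocks {L = L} {K} {𝓑 = 𝓑} (proj₁ mL) (λ x → proj₂ (onBlocks x)))
  where
  ≤-of-supports-meet : ∀ L₁ L₂ → MinimalNormal L₁ K → MinimalNormal L₂ K →
                       ∀ {x} → Supp L₁ x → Supp L₂ x → L₁ ≤G L₂
  ≤-of-supports-meet L₁ L₂ mL₁ mL₂ {x} =
    minimalNormal-≤-of-supports-meet {K = K} {L₁} {L₂} T simple nonabelian (proj₁ (onBlocks x))
      mL₁ (proj₁ mL₂) (IsEquivalence.refl (isEquivalence 𝓑))
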